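{- For every family $D$ of complete patterns over $U$, there exists a family $C$ of CS-patterns over $U$ that parity-represents $D$, i.e., for every complete pattern $q$ over $U$, $|\{p\in C: p\sim q\}|\equiv|\{p\in D:p\sim q\}|\pmod 2$.
   Context: Let $U$ be a finite totally ordered set and $0\notin U$. A pattern over $U$ is a set $p$ of subsets of $U\cup\{0\}$ such that exactly one member of $p$ contains $0$. Let $\mathrm{lbs}(p)=\bigcup_{S\in p}S\setminus\{0\}$ and $\mathrm{sing}(p)=\{u\in U:\{u\}\in p\}$; $p$ is complete if $\mathrm{lbs}(p)=\mathrm{sing}(p)$. The CS-patterns over $U$ are the patterns $\{X\cup\{0\}\}\cup\{\{u\}:u\in Y\}$ for $X\subseteq Y\subseteq U$. For patterns $p,q$, the join $p\sqcup q$ is obtained by relating $S\in p$ and $T\in q$ whenever $S\cap T\neq\emptyset$, taking the equivalence closure on the members of $p$ and $q$, and forming the union of the members of each class. Patterns $p,q$ are consistent, $p\sim q$, if $p\sqcup q$ consists of a single set. -}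

module Defs where

open import Data.Nat using (ℕ; zero; suc)
open import Data.Bool using (Bool; true; false)
open import Data.Fin using (Fin) renaming (zero to fzero; suc to fsuc)
open import Data.Fin.Subset using (Subset; _∈_; _∩_; _⊆_; Nonempty; ⁅_⁆)
open import Data.Vec using (_∷_)
open import Data.Product using (Σ; ∃; _×_; _,_; proj₁)
open import Data.Sum using (_⊎_; inj₁; inj₂)
open import Data.Empty using (⊥)
open import Data.List using (List; []; _∷_)
open import Relation.Nullary using (¬_)
open import Relation.Binary.PropositionalEquality using (_≡_)
open import Relation.Binary.Construct.Closure.Equivalence using (EqClosure)
open import Function.Bundles using (_⇔_)

-- The finite totally ordered set U is Fin n (with its usual
-- order).  U ∪ {0} is represented by Fin (suc n): the element 0 is fzero and
-- u ∈ U is represented by fsuc u.  A subset of U ∪ {0} is a Subset (suc n).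
-- A set of subsets of U ∪ {0} is given by its (Bool-valued) characteristic
-- function.

Pat : ℕ → Set
Pat n = Subset (suc n) → Bool

_∈ₚ_ : ∀ {n} → Subset (suc n) → Pat n → Set
S ∈ₚ p = p S ≡ true

IsPattern : ∀ {n} → Pat n → Set
IsPattern {n} p = Σ (Subset (suc n)) λ S →
  (S ∈ₚ p) × (fzero ∈ S) × (∀ T → T ∈ₚ p → fzero ∈ T → T ≡ S)

_∈lbs_ : ∀ {n} → Fin n → Pat n → Set
_∈lbs_ {n} u p = Σ (Subset (suc n)) λ S → (S ∈ₚ p) × (fsuc u ∈ S)

_∈sing_ : ∀ {n} → Fin n → Pat n → Set
u ∈sing p = ⁅ fsuc u ⁆ ∈ₚ p

Complete : ∀ {n} → Pat n → Set
Complete {n} p = (u : Fin n) → (u ∈lbs p) ⇔ (u ∈sing p)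

-- CS-patterns: { X ∪ {0} } ∪ { {u} : u ∈ Y } with X ⊆ Y ⊆ U
-- (X ∪ {0} is  true ∷ X ;  {u} for u ∈ U is ⁅ fsuc u ⁆)
IsCS : ∀ {n} → Pat n → Set
IsCS {n} p = Σ (Subset n) λ X → Σ (Subset n) λ Y → (X ⊆ Y) ×
  ((S : Subset (suc n)) →
     (S ∈ₚ p) ⇔ ((S ≡ (true ∷ X)) ⊎ (Σ (Fin n) λ u → (u ∈ Y) × (S ≡ ⁅ fsuc u ⁆))))

-- Join.  Nodes are the members of p together with the members of q
-- (kept apart as a disjoint union).
Node : ∀ {n} → Pat n → Pat n → Set
Node {n} p q = (Σ (Subset (suc n)) λ S → S ∈ₚ p) ⊎ (Σ (Subset (suc n)) λ T → T ∈ₚ q)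

nodeSet : ∀ {n} {p q : Pat n} → Node p q → Subset (suc n)
nodeSet (inj₁ (S , _)) = S
nodeSet (inj₂ (T , _)) = T

Rel₀ : ∀ {n} {p q : Pat n} → Node p q → Node p q → Set
Rel₀ (inj₁ (S , _)) (inj₂ (T , _)) = Nonempty (S ∩ T)
Rel₀ _ _ = ⊥

_∈class_ : ∀ {n} {p q : Pat n} → Fin (suc n) → Node p q → Set
_∈class_ {p = p} {q} x a =
  Σ (Node p q) λ b → EqClosure (Rel₀ {p = p} {q}) a b × (x ∈ nodeSet b)

_∈join_,_ : ∀ {n} → Subset (suc n) → Pat n → Pat n → Set
_∈join_,_ {n} W p q =
  Σ (Node p q) λ a → (x : Fin (suc n)) → (x ∈ W) ⇔ (_∈class_ {p = p} {q} x a)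

_∼_ : ∀ {n} → Pat n → Pat n → Set
_∼_ {n} p q = Σ (Subset (suc n)) λ W → (V : Subset (suc n)) → (V ∈join p , q) ⇔ (V ≡ W)

data Count {A : Set} (P : A → Set) : List A → ℕ → Set where
  nil  : Count P [] 0
  here : ∀ {x xs k} → P x → Count P xs k → Count P (x ∷ xs) (suc k)
  skip : ∀ {x xs k} → ¬ P x → Count P xs k → Count P (x ∷ xs) k

{-# OPTIONS --safe #-}

-- For complete patterns p and q, p ∼ q holds iff neither contains ∅, sing p = sing q, and the
-- only W ⊆ sing p that separates both patterns (each member lies inside W or misses it) is ∅:
-- a class of p ⊔ q avoiding 0 is such a separator, and so is the part of sing p outside a class
-- containing 0. Common separators are closed under symmetric difference, so ∅ is the only one iff
-- their number is odd, and mod 2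
--   [p ∼ q] = [∅ ∉ p] [∅ ∉ q] [sing p = sing q] Σ_W [W separates p] [W separates q].
-- The CS-pattern with X = Y ∖ Z is separated by W ⊆ Y iff W ⊆ Z. Hence Möbius inversion on the
-- Boolean lattice mod 2 yields coefficients c(Y, Z) with Σ_{Y,Z} c(Y, Z) [cs (Y ∖ Z) Y ∼ q]
-- ≡ Σ_{p ∈ D} [p ∼ q], and C consists of the cs (Y ∖ Z) Y with c(Y, Z) odd.
module Submission where

open import Algebra.Bundles using (CommutativeMonoid; CommutativeRing)
import Algebra.Properties.CommutativeSemigroup as CommSemigroupProps
open import Data.Bool using (Bool; true; false; not; _∧_; _xor_; if_then_else_; _≟_)
import Data.Bool.Properties as Bool
open import Data.Bool.Properties
  using (∧-comm; ∧-assoc; ∧-zeroʳ; ∧-distribˡ-xor; xor-comm; xor-assoc; xor-same; xor-identityʳ;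
         ¬-not; not-involutive)
open import Data.Fin using (Fin) renaming (zero to fzero; suc to fsuc)
open import Data.Fin.Properties using (any?; suc-injective)
open import Data.Fin.Subset
  using (Subset; inside; outside; _∈_; _∉_; _⊆_; _⊂_; _∩_; _∪_; _─_; ⊥; ⁅_⁆; ∣_∣; Nonempty; Empty)
open import Data.Fin.Subset.Properties
  using (_⊆?_; _⊂?_; _∈?_; nonempty?; anySubset?; ⊆-antisym; ⊆-trans; ⊥⊆; ∉⊥; in⊆in; drop-there;
         x∈p∩q⁺; x∈p∩q⁻; x∈p∪q⁺; x∈p∪q⁻; x∈⁅x⁆; x∈⁅y⁆⇒x≡y; Empty-unique; p─q⊆p; x∈p∧x∉q⇒x∈p─q;
         ∣p∣≤n; p⊆q⇒∣p∣≤∣q∣; p⊂q⇒∣p∣<∣q∣)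
open import Data.List using (List; []; _∷_; _++_; map; filter; cartesianProduct)
open import Data.List.Membership.Propositional.Properties using (∈-map⁻)
open import Data.List.Relation.Binary.Disjoint.Propositional using (Disjoint)
open import Data.List.Relation.Unary.All using (All; []; _∷_)
import Data.List.Relation.Unary.All as All
import Data.List.Relation.Unary.All.Properties as All
open import Data.List.Relation.Unary.AllPairs using (AllPairs; []; _∷_)
import Data.List.Relation.Unary.AllPairs.Properties as AllPairs
open import Data.List.Relation.Unary.Unique.Propositional using (Unique)
import Data.List.Relation.Unary.Unique.Propositional.Properties as Unique
open import Data.Nat using (ℕ; zero; suc; _+_; _%_; _≤_; _<_; z≤n)
open import Data.Nat.DivMod using ([m+n]%n≡m%n)
open import Data.Nat.GeneralisedArithmetic using (fold)
open import Data.Nat.Properties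
  using (+-comm; ≤-trans; ≤-<-trans; ≤-reflexive; n≮n; +-mono-≤; +-mono-<-≤; +-mono-≤-<)
open import Data.Product using (Σ; ∃; _×_; _,_; proj₁; proj₂)
open import Data.Sum using (_⊎_; inj₁; inj₂)
import Data.Sum as Sum
open import Data.Vec using ([]; _∷_; here; there; zipWith; tail; tabulate)
import Data.Vec.Properties as Vec
open import Data.Vec.Properties
  using (∷-injectiveʳ; zipWith-comm; tabulate-cong; lookup∘tabulate; []=⇒lookup; lookup⇒[]=)
open import Function using (_∘_; _$_; _⇔_; mk⇔; Equivalence)
open import Relation.Binary.Construct.Closure.Equivalence using (EqClosure)
open import Relation.Binary.Construct.Closure.ReflexiveTransitive using (ε; _◅_; _◅◅_)
open import Relation.Binary.Construct.Closure.Symmetric using (SymClosure; fwd; bwd)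
open import Relation.Binary.Definitions using (DecidableEquality)
open import Relation.Binary.PropositionalEquality
  using (_≡_; _≢_; _≗_; refl; sym; trans; cong; cong₂; subst; module ≡-Reasoning)
open import Relation.Nullary
  using (Dec; yes; no; does; ¬_; ¬?; _×-dec_; _⊎-dec_; _→-dec_; contradiction; map′; decidable-stable)
open import Relation.Nullary.Decidable using (dec-true; dec-false; does-⇔; toSum)
open import Relation.Unary using (Decidable)

open import Defs

module ∧ = CommSemigroupProps (CommutativeMonoid.commutativeSemigroup Bool.∧-commutativeMonoid)
module xor = CommSemigroupProps
  (CommutativeMonoid.commutativeSemigroup (CommutativeRing.+-commutativeMonoid Bool.xor-∧-commutativeRing))

infix 4 _≟ₛ_

_≟ₛ_ : ∀ {k} → DecidableEquality (Subset k)
_≟ₛ_ = Vec.≡-dec Bool._≟_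

does⇒ : ∀ {a} {A : Set a} (a? : Dec A) → does a? ≡ true → A
does⇒ (yes a) _ = a

∧≡true⇒ : ∀ {a b} → a ∧ b ≡ true → a ≡ true × b ≡ true
∧≡true⇒ {true} {true} _ = refl , refl

≡true-ext : ∀ {a b} → (a ≡ true → b ≡ true) → (b ≡ true → a ≡ true) → a ≡ b
≡true-ext {false} {false} _ _ = refl
≡true-ext {false} {true}  _ b⇒a = b⇒a refl
≡true-ext {true}  {b}     a⇒b _ = sym (a⇒b refl)

subsetOf : ∀ {k p} {P : Fin k → Set p} → Decidable P → Subset k
subsetOf P? = tabulate (does ∘ P?)

∈-subsetOf⇔ : ∀ {k p} {P : Fin k → Set p} (P? : Decidable P) {x} → x ∈ subsetOf P? ⇔ P x
∈-subsetOf⇔ P? {x} = mk⇔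
  (λ x∈ → does⇒ (P? x) (trans (sym (lookup∘tabulate (does ∘ P?) x)) ([]=⇒lookup x∈)))
  (λ Px → lookup⇒[]= x _ (trans (lookup∘tabulate (does ∘ P?) x) (dec-true (P? x) Px)))

allSubsets? : ∀ {k p} {P : Subset k → Set p} → Decidable P → Dec (∀ S → P S)
allSubsets? P? = map′
  (λ ¬∃¬P S → decidable-stable (P? S) (λ ¬PS → ¬∃¬P (S , ¬PS)))
  (λ ∀P (S , ¬PS) → ¬PS (∀P S))
  (¬? (anySubset? (¬? ∘ P?)))

meets : ∀ {k} {S A : Subset k} {x} → x ∈ S → x ∈ A → Nonempty (S ∩ A)
meets x∈S x∈A = _ , x∈p∩q⁺ (x∈S , x∈A)

Empty∩⇒∉ : ∀ {k} {S A : Subset k} {x} → Empty (S ∩ A) → x ∈ S → x ∉ A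
Empty∩⇒∉ S∩A=∅ x∈S x∈A = S∩A=∅ (_ , x∈p∩q⁺ (x∈S , x∈A))

⊆⇒≡⊎⊂ : ∀ {k} {A B : Subset k} → A ⊆ B → A ≡ B ⊎ A ⊂ B
⊆⇒≡⊎⊂ {A = A} {B} A⊆B with A ⊂? B
... | yes A⊂B = inj₂ A⊂B
... | no  A⊄B = inj₁ (⊆-antisym A⊆B λ {x} x∈B →
  decidable-stable (x ∈? A) (λ x∉A → A⊄B (A⊆B , x , x∈B , x∉A)))

x∈p─q⇒x∉q : ∀ {k} {A B : Subset k} {x} → x ∈ A ─ B → x ∉ B
x∈p─q⇒x∉q {A = _ ∷ _} {outside ∷ _} here ()
x∈p─q⇒x∉q {A = _ ∷ _} {_ ∷ _} (there x∈) (there x∈B) = x∈p─q⇒x∉q x∈ x∈B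

─≡⊥⇒⊆ : ∀ {k} {Y V : Subset k} → Y ─ V ≡ ⊥ → Y ⊆ V
─≡⊥⇒⊆ {V = V} Y─V≡⊥ {x} x∈Y =
  decidable-stable (x ∈? V) λ x∉V → ∉⊥ (subst (x ∈_) Y─V≡⊥ (x∈p∧x∉q⇒x∈p─q x∈Y x∉V))

─-involutive : ∀ {k} {Y Z : Subset k} → Z ⊆ Y → Y ─ (Y ─ Z) ≡ Z
─-involutive {Y = Y} {Z} Z⊆Y = ⊆-antisym
  (λ {x} x∈ → decidable-stable (x ∈? Z) λ x∉Z →
     x∈p─q⇒x∉q x∈ (x∈p∧x∉q⇒x∈p─q (p─q⊆p Y _ x∈) x∉Z))
  (λ x∈Z → x∈p∧x∉q⇒x∈p─q (Z⊆Y x∈Z) (λ x∈Y─Z → x∈p─q⇒x∉q x∈Y─Z x∈Z))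

disjoint-from-─⇔ : ∀ {k} {Y Z W : Subset k} → W ⊆ Y → Empty ((Y ─ Z) ∩ W) ⇔ W ⊆ Z
disjoint-from-─⇔ {Y = Y} {Z} {W} W⊆Y = mk⇔
  (λ ∅ {x} x∈W → decidable-stable (x ∈? Z) λ x∉Z → ∅ (meets (x∈p∧x∉q⇒x∈p─q (W⊆Y x∈W) x∉Z) x∈W))
  (λ W⊆Z (x , x∈) → let x∈Y─Z , x∈W = x∈p∩q⁻ (Y ─ Z) W x∈ in x∈p─q⇒x∉q x∈Y─Z (W⊆Z x∈W))

_⊕_ : ∀ {k} → Subset k → Subset k → Subset k
_⊕_ = zipWith _xor_

⊕-cancelʳ : ∀ {k} (W K : Subset k) → (W ⊕ K) ⊕ K ≡ W
⊕-cancelʳ []      []      = refl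
⊕-cancelʳ (w ∷ W) (k ∷ K) =
  cong₂ _∷_ (trans (xor-assoc w k k) (trans (cong (w xor_) (xor-same k)) (xor-identityʳ w)))
            (⊕-cancelʳ W K)

∈-⊕⁻ : ∀ {k x} {W K : Subset k} → x ∈ W ⊕ K → x ∈ W ⊎ x ∈ K
∈-⊕⁻ {W = inside  ∷ _} {outside ∷ _} here       = inj₁ here
∈-⊕⁻ {W = outside ∷ _} {inside  ∷ _} here       = inj₂ here
∈-⊕⁻ {W = _ ∷ _}       {_ ∷ _}       (there x∈) = Sum.map there there (∈-⊕⁻ x∈)

∉-⊕ : ∀ {k x} {W K : Subset k} → x ∈ W → x ∈ K → x ∉ W ⊕ K
∉-⊕ here       here       ()
∉-⊕ {W = _ ∷ _} {_ ∷ _} (there x∈) (there y∈) (there z∈) = ∉-⊕ x∈ y∈ z∈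

∈-⊕⁺ˡ : ∀ {k x} {W K : Subset k} → x ∈ W → x ∉ K → x ∈ W ⊕ K
∈-⊕⁺ˡ {K = inside  ∷ K} here       x∉ = contradiction here x∉
∈-⊕⁺ˡ {K = outside ∷ K} here       x∉ = here
∈-⊕⁺ˡ {W = _ ∷ _} {_ ∷ _} (there x∈) x∉ = there (∈-⊕⁺ˡ x∈ (x∉ ∘ there))

∈-⊕⁺ʳ : ∀ {k x} {W K : Subset k} → x ∉ W → x ∈ K → x ∈ W ⊕ K
∈-⊕⁺ʳ {W = W} {K} x∉ x∈ rewrite zipWith-comm xor-comm W K = ∈-⊕⁺ˡ x∈ x∉

-- Parity sums

parity : ∀ n → (Subset n → Bool) → Bool
parity zero    f = f []
parity (suc n) f = parity n (f ∘ (inside ∷_)) xor parity n (f ∘ (outside ∷_))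

parity-cong : ∀ n {f g : Subset n → Bool} → (∀ W → f W ≡ g W) → parity n f ≡ parity n g
parity-cong zero    f≗g = f≗g []
parity-cong (suc n) f≗g =
  cong₂ _xor_ (parity-cong n (f≗g ∘ (inside ∷_))) (parity-cong n (f≗g ∘ (outside ∷_)))

parity-false : ∀ n {f : Subset n → Bool} → (∀ W → f W ≡ false) → parity n f ≡ false
parity-false zero    f≗false = f≗false []
parity-false (suc n) f≗false =
  cong₂ _xor_ (parity-false n (f≗false ∘ (inside ∷_))) (parity-false n (f≗false ∘ (outside ∷_)))

∧-distribˡ-parity : ∀ n b (f : Subset n → Bool) → b ∧ parity n f ≡ parity n (λ W → b ∧ f W)
∧-distribˡ-parity zero    b f = refl
∧-distribˡ-parity (suc n) b f = trans (∧-distribˡ-xor b _ _)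
  (cong₂ _xor_ (∧-distribˡ-parity n b _) (∧-distribˡ-parity n b _))

∧-distribʳ-parity : ∀ n b (f : Subset n → Bool) → parity n f ∧ b ≡ parity n (λ W → f W ∧ b)
∧-distribʳ-parity n b f = trans (∧-comm (parity n f) b)
  (trans (∧-distribˡ-parity n b f) (parity-cong n (λ W → ∧-comm b (f W))))

parity-xor : ∀ n (f g : Subset n → Bool) →
  parity n (λ W → f W xor g W) ≡ parity n f xor parity n g
parity-xor zero    f g = refl
parity-xor (suc n) f g =
  trans (cong₂ _xor_ (parity-xor n (f ∘ (inside ∷_)) (g ∘ (inside ∷_)))
                     (parity-xor n (f ∘ (outside ∷_)) (g ∘ (outside ∷_))))
        (xor.interchange (parity n (f ∘ (inside ∷_))) (parity n (g ∘ (inside ∷_)))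
                         (parity n (f ∘ (outside ∷_))) (parity n (g ∘ (outside ∷_))))

parity-comm : ∀ n m (f : Subset n → Subset m → Bool) →
  parity n (λ X → parity m (f X)) ≡ parity m (λ Y → parity n (λ X → f X Y))
parity-comm zero    m f = refl
parity-comm (suc n) m f =
  trans (cong₂ _xor_ (parity-comm n m (f ∘ (inside ∷_))) (parity-comm n m (f ∘ (outside ∷_))))
        (sym (parity-xor m _ _))

parity-true⇒∃ : ∀ n (f : Subset n → Bool) → parity n f ≡ true → ∃ λ W → f W ≡ true
parity-true⇒∃ zero    f fW = [] , fW
parity-true⇒∃ (suc n) f odd with parity n (f ∘ (inside ∷_)) in eq
... | true  = let W , fW = parity-true⇒∃ n _ eq  in inside ∷ W , fW
... | false = let W , fW = parity-true⇒∃ n _ odd in outside ∷ W , fW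

parity-⊕-invariant : ∀ n K (f : Subset n → Bool) → parity n (λ W → f (W ⊕ K)) ≡ parity n f
parity-⊕-invariant zero    []            f = refl
parity-⊕-invariant (suc n) (outside ∷ K) f =
  cong₂ _xor_ (parity-⊕-invariant n K (f ∘ (inside ∷_))) (parity-⊕-invariant n K (f ∘ (outside ∷_)))
parity-⊕-invariant (suc n) (inside ∷ K)  f =
  trans (cong₂ _xor_ (parity-⊕-invariant n K (f ∘ (outside ∷_)))
                     (parity-⊕-invariant n K (f ∘ (inside ∷_))))
        (xor-comm (parity n (f ∘ (outside ∷_))) _)

parity-vanishes : ∀ n K (f : Subset n → Bool) → K ≢ ⊥ → (∀ W → f (W ⊕ K) ≡ f W) →
  parity n f ≡ false
parity-vanishes zero    []            f K≢⊥ f-inv = contradiction refl K≢⊥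
parity-vanishes (suc n) (outside ∷ K) f K≢⊥ f-inv = cong₂ _xor_
  (parity-vanishes n K (f ∘ (inside ∷_))  (K≢⊥ ∘ cong (outside ∷_)) (f-inv ∘ (inside ∷_)))
  (parity-vanishes n K (f ∘ (outside ∷_)) (K≢⊥ ∘ cong (outside ∷_)) (f-inv ∘ (outside ∷_)))
parity-vanishes (suc n) (inside ∷ K)  f K≢⊥ f-inv = begin
  parity n (f ∘ (inside ∷_)) xor parity n (f ∘ (outside ∷_))
    ≡⟨ cong (_xor parity n (f ∘ (outside ∷_))) (begin
         parity n (f ∘ (inside ∷_))                  ≡⟨ sym (parity-⊕-invariant n K (f ∘ (inside ∷_))) ⟩
         parity n (λ W → f (inside ∷ (W ⊕ K)))      ≡⟨ parity-cong n (f-inv ∘ (outside ∷_)) ⟩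
         parity n (f ∘ (outside ∷_))                 ∎) ⟩
  parity n (f ∘ (outside ∷_)) xor parity n (f ∘ (outside ∷_))
    ≡⟨ xor-same (parity n (f ∘ (outside ∷_))) ⟩
  false ∎
  where open ≡-Reasoning

parity-singleton : ∀ n (f : Subset n → Bool) → (∀ W → f W ≡ true → W ≡ ⊥) → f ⊥ ≡ true →
  parity n f ≡ true
parity-singleton zero    f only-⊥ f⊥ = f⊥
parity-singleton (suc n) f only-⊥ f⊥ = trans
  (cong (_xor parity n (f ∘ (outside ∷_)))
        (parity-false n (λ W → ¬-not (λ fW → contradiction (only-⊥ (inside ∷ W) fW) λ ()))))
  (parity-singleton n (f ∘ (outside ∷_)) (λ W → cong tail ∘ only-⊥ (outside ∷ W)) f⊥)

parity-subspace : ∀ n (f : Subset n → Bool) → f ⊥ ≡ true →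
  (∀ W K → f W ≡ true → f K ≡ true → f (W ⊕ K) ≡ true) →
  parity n f ≡ true ⇔ (∀ W → f W ≡ true → W ≡ ⊥)
parity-subspace n f f⊥ ⊕-closed = mk⇔ only-⊥ (λ only → parity-singleton n f only f⊥)
  where
  only-⊥ : parity n f ≡ true → ∀ W → f W ≡ true → W ≡ ⊥
  only-⊥ odd W fW with W ≟ₛ ⊥
  ... | yes W≡⊥ = W≡⊥
  ... | no  W≢⊥ = contradiction (trans (sym odd) (parity-vanishes n W f W≢⊥ shift)) λ ()
    where
    shift : ∀ V → f (V ⊕ W) ≡ f V
    shift V = ≡true-ext (λ fVW → trans (cong f (sym (⊕-cancelʳ V W))) (⊕-closed _ W fVW fW))
                        (λ fV → ⊕-closed V W fV fW)

parity-interval : ∀ n (W V : Subset n) →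
  parity n (λ Z → does (W ⊆? Z) ∧ does (Z ⊆? V)) ≡ does (W ≟ₛ V)
parity-interval zero    []            []            = refl
parity-interval (suc n) (inside ∷ W)  (inside ∷ V)  =
  trans (cong (parity n (λ Z → does (W ⊆? Z) ∧ does (Z ⊆? V)) xor_) (parity-false n (λ _ → refl)))
        (trans (xor-identityʳ _) (parity-interval n W V))
parity-interval (suc n) (inside ∷ W)  (outside ∷ V) =
  cong₂ _xor_ (parity-false n (λ Z → ∧-zeroʳ (does (W ⊆? Z)))) (parity-false n (λ _ → refl))
parity-interval (suc n) (outside ∷ W) (inside ∷ V)  =
  xor-same (parity n (λ Z → does (W ⊆? Z) ∧ does (Z ⊆? V)))
parity-interval (suc n) (outside ∷ W) (outside ∷ V) =
  trans (cong (_xor parity n (λ Z → does (W ⊆? Z) ∧ does (Z ⊆? V)))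
              (parity-false n (λ Z → ∧-zeroʳ (does (W ⊆? Z)))))
        (parity-interval n W V)

parity-point : ∀ n (L : Subset n) (F : Subset n → Bool) →
  parity n (λ Y → does (Y ≟ₛ L) ∧ F Y) ≡ F L
parity-point zero    []            F = refl
parity-point (suc n) (inside ∷ L)  F =
  trans (cong (parity n (λ Y → does (Y ≟ₛ L) ∧ F (inside ∷ Y)) xor_) (parity-false n (λ _ → refl)))
        (trans (xor-identityʳ _) (parity-point n L (F ∘ (inside ∷_))))
parity-point (suc n) (outside ∷ L) F =
  trans (cong (_xor parity n (λ Y → does (Y ≟ₛ L) ∧ F (outside ∷ Y))) (parity-false n (λ _ → refl)))
        (parity-point n L (F ∘ (outside ∷_)))

parity-möbius : ∀ n (w s : Subset n → Bool) →
  parity n (λ Z → parity n (λ V → does (Z ⊆? V) ∧ w V) ∧ parity n (λ W → does (W ⊆? Z) ∧ s W))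
  ≡ parity n (λ V → w V ∧ s V)
parity-möbius n w s = begin
  parity n (λ Z → parity n (λ V → does (Z ⊆? V) ∧ w V) ∧ parity n (λ W → does (W ⊆? Z) ∧ s W))
    ≡⟨ parity-cong n expand ⟩
  parity n (λ Z → parity n (λ V → parity n (λ W → summand V W Z)))
    ≡⟨ parity-comm n n _ ⟩
  parity n (λ V → parity n (λ Z → parity n (λ W → summand V W Z)))
    ≡⟨ parity-cong n (λ V → parity-comm n n (λ Z W → summand V W Z)) ⟩
  parity n (λ V → parity n (λ W → parity n (λ Z → summand V W Z)))
    ≡⟨ parity-cong n (λ V → parity-cong n λ W → trans (sym (∧-distribˡ-parity n (w V ∧ s W) _))
                                                      (cong ((w V ∧ s W) ∧_) (parity-interval n W V))) ⟩
  parity n (λ V → parity n (λ W → (w V ∧ s W) ∧ does (W ≟ₛ V)))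
    ≡⟨ parity-cong n (λ V → trans (parity-cong n λ W → ∧-comm (w V ∧ s W) _)
                                  (parity-point n V (λ W → w V ∧ s W))) ⟩
  parity n (λ V → w V ∧ s V) ∎
  where
  open ≡-Reasoning
  summand : Subset n → Subset n → Subset n → Bool
  summand V W Z = (w V ∧ s W) ∧ (does (W ⊆? Z) ∧ does (Z ⊆? V))
  expand : ∀ Z → parity n (λ V → does (Z ⊆? V) ∧ w V) ∧ parity n (λ W → does (W ⊆? Z) ∧ s W)
                 ≡ parity n (λ V → parity n (λ W → summand V W Z))
  expand Z = trans (∧-distribʳ-parity n _ _) (parity-cong n λ V →
    trans (∧-distribˡ-parity n _ _) (parity-cong n λ W → begin
      (does (Z ⊆? V) ∧ w V) ∧ (does (W ⊆? Z) ∧ s W)  ≡⟨ ∧.interchange (does (Z ⊆? V)) (w V) _ _ ⟩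
      (does (Z ⊆? V) ∧ does (W ⊆? Z)) ∧ (w V ∧ s W)  ≡⟨ ∧-comm _ (w V ∧ s W) ⟩
      (w V ∧ s W) ∧ (does (Z ⊆? V) ∧ does (W ⊆? Z))  ≡⟨ cong ((w V ∧ s W) ∧_) (∧-comm (does (Z ⊆? V)) _) ⟩
      summand V W Z                                   ∎))

parityOf : ∀ {A : Set} → (A → Bool) → List A → Bool
parityOf g []       = false
parityOf g (x ∷ xs) = g x xor parityOf g xs

module _ {A : Set} where

  parityOf-cong : ∀ {g h : A → Bool} xs → (∀ x → g x ≡ h x) → parityOf g xs ≡ parityOf h xs
  parityOf-cong []       g≗h = refl
  parityOf-cong (x ∷ xs) g≗h = cong₂ _xor_ (g≗h x) (parityOf-cong xs g≗h)

  parityOf-++ : ∀ (g : A → Bool) xs ys → parityOf g (xs ++ ys) ≡ parityOf g xs xor parityOf g ys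
  parityOf-++ g []       ys = refl
  parityOf-++ g (x ∷ xs) ys =
    trans (cong (g x xor_) (parityOf-++ g xs ys)) (sym (xor-assoc (g x) (parityOf g xs) _))

  parityOf-map : ∀ {B : Set} (g : B → Bool) (f : A → B) xs →
    parityOf g (map f xs) ≡ parityOf (g ∘ f) xs
  parityOf-map g f []       = refl
  parityOf-map g f (x ∷ xs) = cong (g (f x) xor_) (parityOf-map g f xs)

  parityOf-filter : ∀ (g c : A → Bool) xs →
    parityOf g (filter (λ x → c x ≟ true) xs) ≡ parityOf (λ x → c x ∧ g x) xs
  parityOf-filter g c []       = refl
  parityOf-filter g c (x ∷ xs) with c x
  ... | true  = cong (g x xor_) (parityOf-filter g c xs)
  ... | false = parityOf-filter g c xs

  ∧-distribˡ-parityOf : ∀ b (g : A → Bool) xs → b ∧ parityOf g xs ≡ parityOf (λ x → b ∧ g x) xs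
  ∧-distribˡ-parityOf b g []       = ∧-zeroʳ b
  ∧-distribˡ-parityOf b g (x ∷ xs) =
    trans (∧-distribˡ-xor b (g x) _) (cong (b ∧ g x xor_) (∧-distribˡ-parityOf b g xs))

  ∧-distribʳ-parityOf : ∀ b (g : A → Bool) xs → parityOf g xs ∧ b ≡ parityOf (λ x → g x ∧ b) xs
  ∧-distribʳ-parityOf b g xs = trans (∧-comm (parityOf g xs) b)
    (trans (∧-distribˡ-parityOf b g xs) (parityOf-cong xs λ x → ∧-comm b (g x)))

  parityOf-true⇒∃ : ∀ (g : A → Bool) xs → parityOf g xs ≡ true → ∃ λ x → g x ≡ true
  parityOf-true⇒∃ g (x ∷ xs) odd with g x in gx
  ... | true  = x , gx
  ... | false = parityOf-true⇒∃ g xs odd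

  parityOf-parity : ∀ n (g : A → Subset n → Bool) xs →
    parityOf (λ x → parity n (g x)) xs ≡ parity n (λ W → parityOf (λ x → g x W) xs)
  parityOf-parity n g []       = sym (parity-false n (λ _ → refl))
  parityOf-parity n g (x ∷ xs) =
    trans (cong (parity n (g x) xor_) (parityOf-parity n g xs)) (sym (parity-xor n (g x) _))

parityOf-cartesianProduct : ∀ {A B : Set} (g : A × B → Bool) xs ys →
  parityOf g (cartesianProduct xs ys) ≡ parityOf (λ x → parityOf (λ y → g (x , y)) ys) xs
parityOf-cartesianProduct g []       ys = refl
parityOf-cartesianProduct g (x ∷ xs) ys = trans (parityOf-++ g (map (x ,_) ys) _)
  (cong₂ _xor_ (parityOf-map g (x ,_) ys) (parityOf-cartesianProduct g xs ys))

subsets : ∀ n → List (Subset n)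
subsets zero    = [] ∷ []
subsets (suc n) = map (inside ∷_) (subsets n) ++ map (outside ∷_) (subsets n)

parityOf-subsets : ∀ n (g : Subset n → Bool) → parityOf g (subsets n) ≡ parity n g
parityOf-subsets zero    g = xor-identityʳ (g [])
parityOf-subsets (suc n) g = trans (parityOf-++ g (map (inside ∷_) (subsets n)) _) (cong₂ _xor_
  (trans (parityOf-map g (inside ∷_) (subsets n))  (parityOf-subsets n _))
  (trans (parityOf-map g (outside ∷_) (subsets n)) (parityOf-subsets n _)))

subsets-unique : ∀ n → Unique (subsets n)
subsets-unique zero    = [] ∷ []
subsets-unique (suc n) = Unique.++⁺ (Unique.map⁺ ∷-injectiveʳ (subsets-unique n))
                                   (Unique.map⁺ ∷-injectiveʳ (subsets-unique n))
                                   head-differs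
  where
  head-differs : Disjoint (map (inside ∷_) (subsets n)) (map (outside ∷_) (subsets n))
  head-differs (W∈ , W∈′) with ∈-map⁻ (inside ∷_) W∈ | ∈-map⁻ (outside ∷_) W∈′
  ... | _ , _ , refl | _ , _ , ()

odd : ℕ → Bool
odd zero    = false
odd (suc k) = not (odd k)

count-odd : ∀ {A : Set} {P : A → Set} (g : A → Bool) {xs k} → Count P xs k →
  All (λ x → P x ⇔ (g x ≡ true)) xs → odd k ≡ parityOf g xs
count-odd g nil             []         = refl
count-odd g (here Px count) (P⇔ ∷ P⇔s) rewrite Equivalence.to P⇔ Px =
  cong not (count-odd g count P⇔s)
count-odd g (skip ¬Px count) (P⇔ ∷ P⇔s) rewrite ¬-not (¬Px ∘ Equivalence.from P⇔) =
  count-odd g count P⇔s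

%2-odd : ∀ k → k % 2 ≡ (if odd k then 1 else 0)
%2-odd zero          = refl
%2-odd (suc zero)    = refl
%2-odd (suc (suc k)) = begin
  suc (suc k) % 2                   ≡⟨ cong (_% 2) (+-comm 2 k) ⟩
  (k + 2) % 2                       ≡⟨ [m+n]%n≡m%n k 2 ⟩
  k % 2                             ≡⟨ %2-odd k ⟩
  (if odd k then 1 else 0)          ≡⟨ cong (if_then 1 else 0) (sym (not-involutive (odd k))) ⟩
  (if odd (suc (suc k)) then 1 else 0) ∎
  where open ≡-Reasoning

odd⇒%2 : ∀ {k l} → odd k ≡ odd l → k % 2 ≡ l % 2
odd⇒%2 {k} {l} odd≡ = trans (%2-odd k) (trans (cong (if_then 1 else 0) odd≡) (sym (%2-odd l)))

AllPairs-mapWithAll : ∀ {A : Set} {P : A → Set} {R S : A → A → Set} →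
  (∀ {x y} → P x → P y → R x y → S x y) → ∀ {xs} → All P xs → AllPairs R xs → AllPairs S xs
AllPairs-mapWithAll f []         []         = []
AllPairs-mapWithAll f (px ∷ pxs) (rs ∷ rss) =
  All.zipWith (λ (py , r) → f px py r) (pxs , rs) ∷ AllPairs-mapWithAll f pxs rss

module Saturation {A : Set} (f : A → A) (size : A → ℕ) (bound : ℕ)
  (progress : ∀ x → f x ≡ x ⊎ size x < size (f x))
  (bounded : ∀ x → size x ≤ bound) where

  private
    fixed-or-large : ∀ x k → f (fold x f k) ≡ fold x f k ⊎ k ≤ size (fold x f k)
    fixed-or-large x zero    = inj₂ z≤n
    fixed-or-large x (suc k) with fixed-or-large x k
    ... | inj₁ fixed = inj₁ (cong f fixed)
    ... | inj₂ k≤ with progress (fold x f k)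
    ...   | inj₁ fixed = inj₁ (cong f fixed)
    ...   | inj₂ grows = inj₂ (≤-<-trans k≤ grows)

  opaque
    saturate : A → A
    saturate x = fold x f (suc bound)

    saturate-fixed : ∀ x → f (saturate x) ≡ saturate x
    saturate-fixed x with fixed-or-large x (suc bound)
    ... | inj₁ fixed = fixed
    ... | inj₂ large = contradiction (≤-trans large (bounded _)) (n≮n bound)

    saturate-preserves : (I : A → Set) → (∀ {x} → I x → I (f x)) → ∀ {x} → I x → I (saturate x)
    saturate-preserves I preserved {x} Ix = go (suc bound)
      where
      go : ∀ k → I (fold x f k)
      go zero    = Ix
      go (suc k) = preserved (go k)

-- Separators and absorbing sets of a pattern

sing : ∀ {n} → Pat n → Subset n
sing r = subsetOf (λ u → r ⁅ fsuc u ⁆ ≟ true)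

∈-sing⇔ : ∀ {n} {r : Pat n} {u} → u ∈ sing r ⇔ u ∈sing r
∈-sing⇔ {r = r} = ∈-subsetOf⇔ (λ u → r ⁅ fsuc u ⁆ ≟ true)

sing-cong : ∀ {n} {p q : Pat n} → p ≗ q → sing p ≡ sing q
sing-cong p≗q = tabulate-cong λ u → cong (does ∘ (_≟ true)) (p≗q ⁅ fsuc u ⁆)

member⊆sing : ∀ {n} {r : Pat n} {S u} → Complete r → S ∈ₚ r → fsuc u ∈ S → u ∈ sing r
member⊆sing {r = r} complete S∈r u∈S =
  Equivalence.from (∈-sing⇔ {r = r}) (Equivalence.to (complete _) (_ , S∈r , u∈S))

member⊆sing-with-0 : ∀ {n} {r : Pat n} {S} → Complete r → S ∈ₚ r → S ⊆ inside ∷ sing r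
member⊆sing-with-0         complete S∈r {fzero}  _   = here
member⊆sing-with-0 {r = r} complete S∈r {fsuc u} u∈S = there (member⊆sing {r = r} complete S∈r u∈S)

sing-with-0-covered : ∀ {n} {r : Pat n} {x} → IsPattern r → x ∈ inside ∷ sing r →
  ∃ λ S → S ∈ₚ r × x ∈ S
sing-with-0-covered {x = fzero}  (S₀ , S₀∈r , 0∈S₀ , _) _          = S₀ , S₀∈r , 0∈S₀
sing-with-0-covered {r = r} {fsuc u} _                 (there u∈) =
  ⁅ fsuc u ⁆ , Equivalence.to (∈-sing⇔ {r = r}) u∈ , x∈⁅x⁆ (fsuc u)

Separates : ∀ {n} → Pat n → Subset n → Set
Separates r W = W ⊆ sing r × (∀ S → S ∈ₚ r → S ⊆ outside ∷ W ⊎ Empty (S ∩ (outside ∷ W)))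

separates? : ∀ {n} (r : Pat n) W → Dec (Separates r W)
separates? r W = (W ⊆? sing r) ×-dec allSubsets? (λ S →
  (r S ≟ true) →-dec ((S ⊆? outside ∷ W) ⊎-dec ¬? (nonempty? (S ∩ (outside ∷ W)))))

separatesᵇ : ∀ {n} → Pat n → Subset n → Bool
separatesᵇ r W = does (separates? r W)

separates-⊥ : ∀ {n} (r : Pat n) → Separates r ⊥
separates-⊥ r = ⊥⊆ , λ S _ → inj₂ λ (_ , x∈) → ∉⊥ (proj₂ (x∈p∩q⁻ S _ x∈))

separates-⊕ : ∀ {n} {r : Pat n} {W K} → Separates r W → Separates r K → Separates r (W ⊕ K)
separates-⊕ {W = W} {K} (W⊆ , sepW) (K⊆ , sepK) =
  (λ x∈ → Sum.[ W⊆ , K⊆ ]′ (∈-⊕⁻ x∈)) , λ S S∈r → split (sepW S S∈r) (sepK S S∈r)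
  where
  split : ∀ {S} {A B : Subset _} → S ⊆ A ⊎ Empty (S ∩ A) → S ⊆ B ⊎ Empty (S ∩ B) →
    S ⊆ A ⊕ B ⊎ Empty (S ∩ (A ⊕ B))
  split {S} (inj₁ S⊆A) (inj₁ S⊆B) = inj₂ λ (_ , x∈) →
    let x∈S , x∈A⊕B = x∈p∩q⁻ S _ x∈ in ∉-⊕ (S⊆A x∈S) (S⊆B x∈S) x∈A⊕B
  split (inj₁ S⊆A) (inj₂ S∩B=∅) = inj₁ λ x∈S → ∈-⊕⁺ˡ (S⊆A x∈S) (Empty∩⇒∉ S∩B=∅ x∈S)
  split (inj₂ S∩A=∅) (inj₁ S⊆B) = inj₁ λ x∈S → ∈-⊕⁺ʳ (Empty∩⇒∉ S∩A=∅ x∈S) (S⊆B x∈S)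
  split {S} (inj₂ S∩A=∅) (inj₂ S∩B=∅) = inj₂ λ (_ , x∈) →
    let x∈S , x∈A⊕B = x∈p∩q⁻ S _ x∈
    in Sum.[ Empty∩⇒∉ S∩A=∅ x∈S , Empty∩⇒∉ S∩B=∅ x∈S ]′ (∈-⊕⁻ x∈A⊕B)

Absorbs : ∀ {n} → Pat n → Subset (suc n) → Subset (suc n) → Set
Absorbs r B A = ∀ S → S ∈ₚ r → Nonempty (S ∩ B) → S ⊆ A

absorbs-⊥ : ∀ {n} {r : Pat n} {A} → Absorbs r ⊥ A
absorbs-⊥ S _ (_ , x∈S∩⊥) = contradiction (proj₂ (x∈p∩q⁻ S ⊥ x∈S∩⊥)) ∉⊥

absorbs-unused-singleton : ∀ {n} {r : Pat n} {u A} → Complete r → ¬ (⁅ fsuc u ⁆ ∈ₚ r) →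
  Absorbs r ⁅ fsuc u ⁆ A
absorbs-unused-singleton {r = r} {u} complete u∉ S S∈r (_ , x∈S∩u) with x∈p∩q⁻ S _ x∈S∩u
... | x∈S , x∈⁅u⁆ rewrite x∈⁅y⁆⇒x≡y (fsuc u) x∈⁅u⁆ =
  contradiction (Equivalence.to (∈-sing⇔ {r = r}) (member⊆sing {r = r} complete S∈r x∈S)) u∉

separates⇒absorbs : ∀ {n} {r : Pat n} {W} → Separates r W → Absorbs r (outside ∷ W) (outside ∷ W)
separates⇒absorbs (_ , separates) S S∈r (_ , x∈S∩W) with separates S S∈r
... | inj₁ S⊆W   = S⊆W
... | inj₂ S∩W=∅ = contradiction (_ , x∈S∩W) S∩W=∅

absorbing-separates : ∀ {n} {r : Pat n} {W} → Absorbs r (outside ∷ W) (outside ∷ W) → W ⊆ sing r →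
  Separates r W
absorbing-separates {W = W} absorbs W⊆ =
  W⊆ , λ S S∈r → Sum.map₁ (absorbs S S∈r) (toSum (nonempty? (S ∩ (outside ∷ W))))

absorbing-complement-separates : ∀ {n} {r : Pat n} {V} → Complete r →
  Absorbs r (inside ∷ V) (inside ∷ V) → Separates r (sing r ─ V)
absorbing-complement-separates {r = r} {V} complete absorbs = p─q⊆p (sing r) V , λ S S∈r →
  Sum.swap (Sum.map (disjoint S S∈r) (covered S S∈r) (toSum (nonempty? (S ∩ (inside ∷ V)))))
  where
  disjoint : ∀ S → S ∈ₚ r → Nonempty (S ∩ (inside ∷ V)) → Empty (S ∩ (outside ∷ (sing r ─ V)))
  disjoint S S∈r meet (_ , x∈) with x∈p∩q⁻ S _ x∈
  ... | x∈S , there u∈ with absorbs S S∈r meet x∈S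
  ...   | there u∈V = x∈p─q⇒x∉q u∈ u∈V
  covered : ∀ S → S ∈ₚ r → Empty (S ∩ (inside ∷ V)) → S ⊆ outside ∷ (sing r ─ V)
  covered S S∈r ¬meet {fzero}  0∈S = contradiction (meets 0∈S here) ¬meet
  covered S S∈r ¬meet {fsuc u} u∈S = there (x∈p∧x∉q⇒x∈p─q (member⊆sing {r = r} complete S∈r u∈S)
                                                          (λ u∈V → ¬meet (meets u∈S (there u∈V))))

private
  extends? : ∀ {n} (r : Pat n) (A B : Subset (suc n)) →
    Decidable (λ x → x ∈ A ⊎ ∃ λ S → S ∈ₚ r × Nonempty (S ∩ B) × x ∈ S)
  extends? r A B x =
    (x ∈? A) ⊎-dec anySubset? (λ S → (r S ≟ true) ×-dec (nonempty? (S ∩ B) ×-dec (x ∈? S)))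

extend : ∀ {n} → Pat n → Subset (suc n) → Subset (suc n) → Subset (suc n)
extend r A B = subsetOf (extends? r A B)

module _ {n} {r : Pat n} {A B : Subset (suc n)} where

  ∈-extend⁻ : ∀ {x} → x ∈ extend r A B → x ∈ A ⊎ ∃ λ S → S ∈ₚ r × Nonempty (S ∩ B) × x ∈ S
  ∈-extend⁻ = Equivalence.to (∈-subsetOf⇔ (extends? r A B))

  ⊆-extend : A ⊆ extend r A B
  ⊆-extend x∈A = Equivalence.from (∈-subsetOf⇔ (extends? r A B)) (inj₁ x∈A)

  extend-absorbs : Absorbs r B (extend r A B)
  extend-absorbs S S∈r S∩B x∈S =
    Equivalence.from (∈-subsetOf⇔ (extends? r A B)) (inj₂ (S , S∈r , S∩B , x∈S))

-- A state (A , B) holds the union of the members of p and of the members of q reached so far;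
-- saturating the initial state of a node under step computes its class.
module Components {n} (p q : Pat n) where

  _≈_ : Node p q → Node p q → Set
  _≈_ = EqClosure (Rel₀ {p = p} {q})

  State : Set
  State = Subset (suc n) × Subset (suc n)

  Closed : State → Set
  Closed st = Absorbs p (proj₂ st) (proj₁ st) × Absorbs q (proj₁ st) (proj₂ st)

  Inside : State → Node p q → Set
  Inside st (inj₁ (S , _)) = S ⊆ proj₁ st
  Inside st (inj₂ (T , _)) = T ⊆ proj₂ st

  InClassˡ InClassʳ : Node p q → Fin (suc n) → Set
  InClassˡ a x = ∃ λ s → a ≈ inj₁ s × x ∈ proj₁ s
  InClassʳ a x = ∃ λ t → a ≈ inj₂ t × x ∈ proj₁ t

  Reached : Node p q → State → Set
  Reached a st = (∀ {x} → x ∈ proj₁ st → InClassˡ a x) × (∀ {x} → x ∈ proj₂ st → InClassʳ a x)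

  inside-step : ∀ {st a b} → Closed st → SymClosure (Rel₀ {p = p} {q}) a b → Inside st a → Inside st b
  inside-step {a = inj₁ (S , _)} {inj₂ (T , T∈q)} (_ , absorbs-q) (fwd (_ , x∈S∩T)) S⊆A =
    let x∈S , x∈T = x∈p∩q⁻ S T x∈S∩T in absorbs-q T T∈q (meets x∈T (S⊆A x∈S))
  inside-step {a = inj₂ (T , _)} {inj₁ (S , S∈p)} (absorbs-p , _) (bwd (_ , x∈S∩T)) T⊆B =
    let x∈S , x∈T = x∈p∩q⁻ S T x∈S∩T in absorbs-p S S∈p (meets x∈S (T⊆B x∈T))
  inside-step {a = inj₁ _} {inj₁ _} _ (fwd ())
  inside-step {a = inj₁ _} {inj₁ _} _ (bwd ())
  inside-step {a = inj₂ _} {inj₂ _} _ (fwd ())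
  inside-step {a = inj₂ _} {inj₂ _} _ (bwd ())
  inside-step {a = inj₂ _} {inj₁ _} _ (fwd ())
  inside-step {a = inj₁ _} {inj₂ _} _ (bwd ())

  inside-≈ : ∀ {st a b} → Closed st → a ≈ b → Inside st a → Inside st b
  inside-≈ closed ε         a-inside = a-inside
  inside-≈ closed (s ◅ a≈b) a-inside = inside-≈ closed a≈b (inside-step closed s a-inside)

  class⊆closed : ∀ {st a x} → Closed st → Inside st a → x ∈class a → x ∈ proj₁ st ⊎ x ∈ proj₂ st
  class⊆closed {st} closed a-inside (b , a≈b , x∈b) = at b (inside-≈ closed a≈b a-inside) x∈b
    where
    at : ∀ b {x} → Inside st b → x ∈ nodeSet b → x ∈ proj₁ st ⊎ x ∈ proj₂ st
    at (inj₁ _) S⊆A x∈S = inj₁ (S⊆A x∈S)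
    at (inj₂ _) T⊆B x∈T = inj₂ (T⊆B x∈T)

  reached⇒class : ∀ {a st x} → Reached a st → x ∈ proj₁ st ⊎ x ∈ proj₂ st → x ∈class a
  reached⇒class (reachedA , _) (inj₁ x∈A) = let s , a≈s , x∈s = reachedA x∈A in inj₁ s , a≈s , x∈s
  reached⇒class (_ , reachedB) (inj₂ x∈B) = let t , a≈t , x∈t = reachedB x∈B in inj₂ t , a≈t , x∈t

  step : State → State
  step st = extend p (proj₁ st) (proj₂ st) , extend q (proj₂ st) (proj₁ st)

  size : State → ℕ
  size st = ∣ proj₁ st ∣ + ∣ proj₂ st ∣

  step-progress : ∀ st → step st ≡ st ⊎ size st < size (step st)
  step-progress (A , B) with ⊆⇒≡⊎⊂ (⊆-extend {r = p} {A} {B}) | ⊆⇒≡⊎⊂ (⊆-extend {r = q} {B} {A})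
  ... | inj₁ A≡ | inj₁ B≡ = inj₁ (sym (cong₂ _,_ A≡ B≡))
  ... | inj₂ A⊂ | _       = inj₂ (+-mono-<-≤ (p⊂q⇒∣p∣<∣q∣ A⊂) (p⊆q⇒∣p∣≤∣q∣ (⊆-extend {r = q} {B} {A})))
  ... | inj₁ A≡ | inj₂ B⊂ = inj₂ (+-mono-≤-< (≤-reflexive (cong ∣_∣ A≡)) (p⊂q⇒∣p∣<∣q∣ B⊂))

  size-bounded : ∀ st → size st ≤ suc n + suc n
  size-bounded (A , B) = +-mono-≤ (∣p∣≤n A) (∣p∣≤n B)

  fixed⇒closed : ∀ {st} → step st ≡ st → Closed st
  fixed⇒closed {A , B} fixed =
      (λ S S∈p meet → subst (S ⊆_) (cong proj₁ fixed) (extend-absorbs {r = p} {A} {B} S S∈p meet))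
    , (λ T T∈q meet → subst (T ⊆_) (cong proj₂ fixed) (extend-absorbs {r = q} {B} {A} T T∈q meet))

  step-inside : ∀ a {st} → Inside st a → Inside (step st) a
  step-inside (inj₁ _) S⊆A = ⊆-extend {r = p} ∘ S⊆A
  step-inside (inj₂ _) T⊆B = ⊆-extend {r = q} ∘ T⊆B

  step-reached : ∀ a {st} → Reached a st → Reached a (step st)
  step-reached a {A , B} (reachedA , reachedB) = reachedA′ , reachedB′
    where
    reachedA′ : ∀ {x} → x ∈ extend p A B → InClassˡ a x
    reachedA′ x∈ with ∈-extend⁻ {r = p} x∈
    ... | inj₁ x∈A = reachedA x∈A
    ... | inj₂ (S , S∈p , (_ , y∈S∩B) , x∈S) =
      let y∈S , y∈B = x∈p∩q⁻ S B y∈S∩B ; t , a≈t , y∈t = reachedB y∈B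
      in (S , S∈p) , a≈t ◅◅ (bwd (_ , x∈p∩q⁺ (y∈S , y∈t)) ◅ ε) , x∈S
    reachedB′ : ∀ {x} → x ∈ extend q B A → InClassʳ a x
    reachedB′ x∈ with ∈-extend⁻ {r = q} x∈
    ... | inj₁ x∈B = reachedB x∈B
    ... | inj₂ (T , T∈q , (_ , y∈T∩A) , x∈T) =
      let y∈T , y∈A = x∈p∩q⁻ T A y∈T∩A ; s , a≈s , y∈s = reachedA y∈A
      in (T , T∈q) , a≈s ◅◅ (fwd (_ , x∈p∩q⁺ (y∈s , y∈T)) ◅ ε) , x∈T

  initial : Node p q → State
  initial (inj₁ (S , _)) = S , ⊥
  initial (inj₂ (T , _)) = ⊥ , T

  initial-inside : ∀ a → Inside (initial a) a
  initial-inside (inj₁ _) x∈S = x∈S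
  initial-inside (inj₂ _) x∈T = x∈T

  initial-reached : ∀ a → Reached a (initial a)
  initial-reached (inj₁ s) = (λ x∈S → s , ε , x∈S) , (λ x∈⊥ → contradiction x∈⊥ ∉⊥)
  initial-reached (inj₂ t) = (λ x∈⊥ → contradiction x∈⊥ ∉⊥) , (λ x∈T → t , ε , x∈T)

  open Saturation step size (suc n + suc n) step-progress size-bounded

  opaque
    reach : Node p q → State
    reach a = saturate (initial a)

    reach-closed : ∀ a → Closed (reach a)
    reach-closed a = fixed⇒closed (saturate-fixed (initial a))

    reach-inside : ∀ a → Inside (reach a) a
    reach-inside a = saturate-preserves (λ st → Inside st a) (step-inside a) (initial-inside a)

    reach-reached : ∀ a → Reached a (reach a)
    reach-reached a = saturate-preserves (Reached a) (step-reached a) (initial-reached a)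

  component : Node p q → Subset (suc n)
  component a = proj₁ (reach a) ∪ proj₂ (reach a)

  component-∈join : ∀ a → component a ∈join p , q
  component-∈join a = a , λ x → mk⇔
    (reached⇒class (reach-reached a) ∘ x∈p∪q⁻ _ _)
    (x∈p∪q⁺ ∘ class⊆closed (reach-closed a) (reach-inside a))

-- Consistency of complete patterns

record Criterion {n} (p q : Pat n) : Set where
  field
    ⊥∉p               : ¬ (⊥ ∈ₚ p)
    ⊥∉q               : ¬ (⊥ ∈ₚ q)
    sing-≡            : sing p ≡ sing q
    separator-trivial : ∀ W → Separates p W → Separates q W → W ≡ ⊥

module Necessity {n} {p q : Pat n} (p-pattern : IsPattern p) (p-complete : Complete p)
                 (q-complete : Complete q) (p∼q : p ∼ q) where
  open Components p q

  private
    S₀ : Subset (suc n)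
    S₀ = proj₁ p-pattern

    a₀ : Node p q
    a₀ = inj₁ (S₀ , proj₁ (proj₂ p-pattern))

    component≡ : ∀ a → component a ≡ proj₁ p∼q
    component≡ a = Equivalence.to (proj₂ p∼q (component a)) (component-∈join a)

  0∈class : ∀ a → fzero ∈class a
  0∈class a = Equivalence.to (proj₂ (component-∈join a) fzero)
    (subst (fzero ∈_) (trans (component≡ a₀) (sym (component≡ a)))
           (x∈p∪q⁺ (inj₁ (reach-inside a₀ (proj₁ (proj₂ (proj₂ p-pattern)))))))

  0∈closed : ∀ {A B} a → Closed (A , B) → Inside (A , B) a → fzero ∈ A ⊎ fzero ∈ B
  0∈closed a closed a-inside = class⊆closed closed a-inside (0∈class a)

  ⊥∉p : ¬ (⊥ ∈ₚ p)
  ⊥∉p ⊥∈p = Sum.[ ∉⊥ , ∉⊥ ]′ (0∈closed (inj₁ (⊥ , ⊥∈p)) (absorbs-⊥ , absorbs-⊥) (λ x∈ → x∈))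

  ⊥∉q : ¬ (⊥ ∈ₚ q)
  ⊥∉q ⊥∈q = Sum.[ ∉⊥ , ∉⊥ ]′ (0∈closed (inj₂ (⊥ , ⊥∈q)) (absorbs-⊥ , absorbs-⊥) (λ x∈ → x∈))

  private
    0∉⁅suc⁆ : ∀ {u : Fin n} → fzero ∉ ⁅ fsuc u ⁆
    0∉⁅suc⁆ ()

  sing-p⊆sing-q : sing p ⊆ sing q
  sing-p⊆sing-q {u} u∈ = Equivalence.from (∈-sing⇔ {r = q}) $
    decidable-stable (q ⁅ fsuc u ⁆ ≟ true) λ u∉q →
      Sum.[ 0∉⁅suc⁆ , ∉⊥ ]′ (0∈closed (inj₁ (⁅ fsuc u ⁆ , Equivalence.to (∈-sing⇔ {r = p}) u∈))
        (absorbs-⊥ , absorbs-unused-singleton {r = q} q-complete u∉q) (λ x∈ → x∈))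

  sing-q⊆sing-p : sing q ⊆ sing p
  sing-q⊆sing-p {u} u∈ = Equivalence.from (∈-sing⇔ {r = p}) $
    decidable-stable (p ⁅ fsuc u ⁆ ≟ true) λ u∉p →
      Sum.[ ∉⊥ , 0∉⁅suc⁆ ]′ (0∈closed (inj₂ (⁅ fsuc u ⁆ , Equivalence.to (∈-sing⇔ {r = q}) u∈))
        (absorbs-unused-singleton {r = p} p-complete u∉p , absorbs-⊥) (λ x∈ → x∈))

  separator-trivial : ∀ W → Separates p W → Separates q W → W ≡ ⊥
  separator-trivial W sep-p sep-q = Empty-unique λ (w , w∈W) →
    Sum.[ 0∉ , 0∉ ]′ (0∈closed (inj₁ (⁅ fsuc w ⁆ , Equivalence.to (∈-sing⇔ {r = p}) (proj₁ sep-p w∈W)))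
                              (separates⇒absorbs sep-p , separates⇒absorbs sep-q)
                              (λ x∈ → subst (_∈ outside ∷ W) (sym (x∈⁅y⁆⇒x≡y _ x∈)) (there w∈W)))
    where
    0∉ : fzero ∉ outside ∷ W
    0∉ ()

  criterion : Criterion p q
  criterion = record
    { ⊥∉p = ⊥∉p ; ⊥∉q = ⊥∉q ; sing-≡ = ⊆-antisym sing-p⊆sing-q sing-q⊆sing-p
    ; separator-trivial = separator-trivial }

module Sufficiency {n} {p q : Pat n} (p-pattern : IsPattern p) (q-pattern : IsPattern q)
                   (p-complete : Complete p) (q-complete : Complete q) (criterion : Criterion p q) where
  open Components p q
  open Criterion criterion

  W* : Subset (suc n)
  W* = inside ∷ sing p

  member⊆W* : ∀ a → nodeSet a ⊆ W*
  member⊆W* (inj₁ (S , S∈p)) = member⊆sing-with-0 {r = p} p-complete S∈p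
  member⊆W* (inj₂ (T , T∈q)) =
    subst (λ Y → T ⊆ inside ∷ Y) (sym sing-≡) (member⊆sing-with-0 {r = q} q-complete T∈q)

  absorbing-trivial : ∀ A → Absorbs p A A → Absorbs q A A → A ⊆ W* → W* ⊆ A ⊎ A ≡ ⊥
  absorbing-trivial (inside ∷ V) absorbs-p absorbs-q _ = inj₁ (in⊆in (─≡⊥⇒⊆ complement≡⊥))
    where
    complement≡⊥ : sing p ─ V ≡ ⊥
    complement≡⊥ = separator-trivial (sing p ─ V)
      (absorbing-complement-separates {r = p} p-complete absorbs-p)
      (subst (λ Y → Separates q (Y ─ V)) (sym sing-≡)
             (absorbing-complement-separates {r = q} q-complete absorbs-q))
  absorbing-trivial (outside ∷ V) absorbs-p absorbs-q A⊆W* = inj₂ (cong (outside ∷_)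
    (separator-trivial V (absorbing-separates {r = p} absorbs-p V⊆)
                         (absorbing-separates {r = q} absorbs-q (subst (V ⊆_) sing-≡ V⊆))))
    where
    V⊆ : V ⊆ sing p
    V⊆ u∈V = drop-there (A⊆W* (there u∈V))

  class⊆W* : ∀ {a x} → x ∈class a → x ∈ W*
  class⊆W* (b , _ , x∈b) = member⊆W* b x∈b

  nonempty-node : ∀ b → nodeSet b ≢ ⊥
  nonempty-node (inj₁ (S , S∈p)) S≡⊥ = ⊥∉p (subst (_∈ₚ p) S≡⊥ S∈p)
  nonempty-node (inj₂ (T , T∈q)) T≡⊥ = ⊥∉q (subst (_∈ₚ q) T≡⊥ T∈q)

  module AtNode (a : Node p q) where
    A B : Subset (suc n)
    A = proj₁ (reach a)
    B = proj₂ (reach a)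

    A⊆W* : A ⊆ W*
    A⊆W* x∈A = let s , _ , x∈s = proj₁ (reach-reached a) x∈A in member⊆W* (inj₁ s) x∈s

    B⊆W* : B ⊆ W*
    B⊆W* x∈B = let t , _ , x∈t = proj₂ (reach-reached a) x∈B in member⊆W* (inj₂ t) x∈t

    A⊆B : A ⊆ B
    A⊆B x∈A with sing-with-0-covered {r = q} q-pattern (subst (λ Y → _ ∈ inside ∷ Y) sing-≡ (A⊆W* x∈A))
    ... | T , T∈q , x∈T = proj₂ (reach-closed a) T T∈q (meets x∈T x∈A) x∈T

    B⊆A : B ⊆ A
    B⊆A x∈B with sing-with-0-covered {r = p} p-pattern (B⊆W* x∈B)
    ... | S , S∈p , x∈S = proj₁ (reach-closed a) S S∈p (meets x∈S x∈B) x∈S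

    node⊆A : nodeSet a ⊆ A
    node⊆A = inside⇒⊆ a (reach-inside a)
      where
      inside⇒⊆ : ∀ b → Inside (reach a) b → nodeSet b ⊆ A
      inside⇒⊆ (inj₁ _) S⊆A = S⊆A
      inside⇒⊆ (inj₂ _) T⊆B = B⊆A ∘ T⊆B

    W*⊆A : W* ⊆ A
    W*⊆A with absorbing-trivial A
      (λ S S∈p (_ , x∈S∩A) → let x∈S , x∈A = x∈p∩q⁻ S A x∈S∩A
                             in proj₁ (reach-closed a) S S∈p (meets x∈S (A⊆B x∈A)))
      (λ T T∈q meet → B⊆A ∘ proj₂ (reach-closed a) T T∈q meet) A⊆W*
    ... | inj₁ W*⊆A = W*⊆A
    ... | inj₂ A≡⊥  = contradiction
      (⊆-antisym (subst (nodeSet a ⊆_) A≡⊥ node⊆A) ⊥⊆) (nonempty-node a)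

  W*⊆class : ∀ a {x} → x ∈ W* → x ∈class a
  W*⊆class a = reached⇒class (reach-reached a) ∘ inj₁ ∘ AtNode.W*⊆A a

  consistent : p ∼ q
  consistent = W* , λ V → mk⇔
    (λ (a , V⇔class) → ⊆-antisym (class⊆W* ∘ Equivalence.to (V⇔class _))
                                 (Equivalence.from (V⇔class _) ∘ W*⊆class a))
    λ { refl → inj₁ (proj₁ p-pattern , proj₁ (proj₂ p-pattern)) , λ _ → mk⇔ (W*⊆class _) class⊆W* }

consistentᵇ : ∀ {n} → Pat n → Pat n → Bool
consistentᵇ {n} p q = not (p ⊥) ∧ (not (q ⊥) ∧ (does (sing p ≟ₛ sing q) ∧
  parity n (λ W → separatesᵇ p W ∧ separatesᵇ q W)))

common-separators-trivial⇔ : ∀ {n} (p q : Pat n) →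
  parity n (λ W → separatesᵇ p W ∧ separatesᵇ q W) ≡ true ⇔
  (∀ W → Separates p W → Separates q W → W ≡ ⊥)
common-separators-trivial⇔ {n} p q = mk⇔
  (λ odd W sep-p sep-q → Equivalence.to subspace odd W (dec-true (common? W) (sep-p , sep-q)))
  (λ trivial → Equivalence.from subspace λ W common →
     let sep-p , sep-q = does⇒ (common? W) common in trivial W sep-p sep-q)
  where
  common? : ∀ W → Dec (Separates p W × Separates q W)
  common? W = separates? p W ×-dec separates? q W
  subspace : parity n (does ∘ common?) ≡ true ⇔ (∀ W → does (common? W) ≡ true → W ≡ ⊥)
  subspace = parity-subspace n (does ∘ common?)
    (dec-true (common? ⊥) (separates-⊥ p , separates-⊥ q))
    (λ W K common-W common-K →
      let sep-pW , sep-qW = does⇒ (common? W) common-W ; sep-pK , sep-qK = does⇒ (common? K) common-K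
      in dec-true (common? (W ⊕ K)) (separates-⊕ sep-pW sep-pK , separates-⊕ sep-qW sep-qK))

criterion⇔consistentᵇ : ∀ {n} (p q : Pat n) → Criterion p q ⇔ consistentᵇ p q ≡ true
criterion⇔consistentᵇ p q = mk⇔ to from
  where
  to : Criterion p q → consistentᵇ p q ≡ true
  to c rewrite ¬-not (Criterion.⊥∉p c) | ¬-not (Criterion.⊥∉q c)
             | dec-true (sing p ≟ₛ sing q) (Criterion.sing-≡ c) =
    Equivalence.from (common-separators-trivial⇔ p q) (Criterion.separator-trivial c)
  from : consistentᵇ p q ≡ true → Criterion p q
  from consistent with p ⊥ in p⊥ | q ⊥ in q⊥ | sing p ≟ₛ sing q
  ... | false | false | yes sing≡ = record
    { ⊥∉p = λ ⊥∈p → contradiction (trans (sym ⊥∈p) p⊥) λ ()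
    ; ⊥∉q = λ ⊥∈q → contradiction (trans (sym ⊥∈q) q⊥) λ ()
    ; sing-≡ = sing≡
    ; separator-trivial = Equivalence.to (common-separators-trivial⇔ p q) consistent }

∼⇔consistentᵇ : ∀ {n} {p q : Pat n} → IsPattern p → Complete p → IsPattern q → Complete q →
  p ∼ q ⇔ consistentᵇ p q ≡ true
∼⇔consistentᵇ {p = p} {q} p-pattern p-complete q-pattern q-complete = mk⇔
  (Equivalence.to (criterion⇔consistentᵇ p q) ∘ Necessity.criterion p-pattern p-complete q-complete)
  (Sufficiency.consistent p-pattern q-pattern p-complete q-complete
    ∘ Equivalence.from (criterion⇔consistentᵇ p q))

-- CS-patterns

CSMember : ∀ {n} → Subset n → Subset n → Subset (suc n) → Set
CSMember {n} X Y S = S ≡ inside ∷ X ⊎ Σ (Fin n) λ u → u ∈ Y × S ≡ ⁅ fsuc u ⁆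

cs? : ∀ {n} (X Y : Subset n) S → Dec (CSMember X Y S)
cs? X Y S = (S ≟ₛ inside ∷ X) ⊎-dec any? (λ u → (u ∈? Y) ×-dec (S ≟ₛ ⁅ fsuc u ⁆))

cs : ∀ {n} → Subset n → Subset n → Pat n
cs X Y S = does (cs? X Y S)

module _ {n} {X Y : Subset n} where

  ∈-cs⁻ : ∀ {S} → S ∈ₚ cs X Y → CSMember X Y S
  ∈-cs⁻ = does⇒ (cs? X Y _)

  zero-member-cs : (inside ∷ X) ∈ₚ cs X Y
  zero-member-cs = dec-true (cs? X Y _) (inj₁ refl)

  singleton-cs : ∀ {u} → u ∈ Y → ⁅ fsuc u ⁆ ∈ₚ cs X Y
  singleton-cs u∈Y = dec-true (cs? X Y _) (inj₂ (_ , u∈Y , refl))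

  cs-isCS : X ⊆ Y → IsCS (cs X Y)
  cs-isCS X⊆Y = X , Y , X⊆Y , λ S → mk⇔ ∈-cs⁻ (dec-true (cs? X Y S))

  cs-isPattern : IsPattern (cs X Y)
  cs-isPattern = inside ∷ X , zero-member-cs , here , λ T T∈cs → zero-member-unique (∈-cs⁻ T∈cs)
    where
    zero-member-unique : ∀ {T} → CSMember X Y T → fzero ∈ T → T ≡ inside ∷ X
    zero-member-unique (inj₁ T≡)              _  = T≡
    zero-member-unique (inj₂ (_ , _ , refl)) ()

  ∈sing-cs⇔ : ∀ {u} → u ∈ sing (cs X Y) ⇔ u ∈ Y
  ∈sing-cs⇔ {u} = mk⇔
    (label∈Y ∘ ∈-cs⁻ ∘ Equivalence.to (∈-sing⇔ {r = cs X Y}))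
    (Equivalence.from (∈-sing⇔ {r = cs X Y}) ∘ singleton-cs)
    where
    label∈Y : CSMember X Y ⁅ fsuc u ⁆ → u ∈ Y
    label∈Y (inj₂ (v , v∈Y , u≡v)) =
      subst (_∈ Y) (sym (x∈⁅y⁆⇒x≡y v (subst (u ∈_) (∷-injectiveʳ u≡v) (x∈⁅x⁆ u)))) v∈Y

  sing-cs : sing (cs X Y) ≡ Y
  sing-cs = ⊆-antisym (Equivalence.to ∈sing-cs⇔) (Equivalence.from ∈sing-cs⇔)

  cs-complete : X ⊆ Y → Complete (cs X Y)
  cs-complete X⊆Y u = mk⇔
    (λ (S , S∈cs , u∈S) → Equivalence.to (∈-sing⇔ {r = cs X Y})
                            (Equivalence.from ∈sing-cs⇔ (member⊆Y (∈-cs⁻ S∈cs) u∈S)))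
    (λ u∈sing → ⁅ fsuc u ⁆ , u∈sing , x∈⁅x⁆ (fsuc u))
    where
    member⊆Y : ∀ {S} → CSMember X Y S → fsuc u ∈ S → u ∈ Y
    member⊆Y (inj₁ refl)             (there u∈X) = X⊆Y u∈X
    member⊆Y (inj₂ (v , v∈Y , refl)) u∈⁅v⁆       =
      subst (_∈ Y) (sym (suc-injective (x∈⁅y⁆⇒x≡y _ u∈⁅v⁆))) v∈Y

  ⊥∉cs : cs X Y ⊥ ≡ false
  ⊥∉cs = dec-false (cs? X Y ⊥) λ where
    (inj₁ ())
    (inj₂ (u , _ , ⊥≡⁅u⁆)) → ∉⊥ (subst (u ∈_) (sym (∷-injectiveʳ ⊥≡⁅u⁆)) (x∈⁅x⁆ u))

  separates-cs⇔ : ∀ {W} → Separates (cs X Y) W ⇔ (W ⊆ Y × Empty (X ∩ W))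
  separates-cs⇔ {W} = mk⇔
    (λ (W⊆sing , separates) →
       subst (W ⊆_) sing-cs W⊆sing , zero-member-disjoint (separates _ zero-member-cs))
    (λ (W⊆Y , X∩W=∅) → subst (W ⊆_) (sym sing-cs) W⊆Y , λ S S∈cs → member-separated X∩W=∅ (∈-cs⁻ S∈cs))
    where
    zero-member-disjoint : (inside ∷ X) ⊆ outside ∷ W ⊎ Empty ((inside ∷ X) ∩ (outside ∷ W)) →
      Empty (X ∩ W)
    zero-member-disjoint (inj₁ ⊆W) = contradiction (⊆W here) λ ()
    zero-member-disjoint (inj₂ ∅)  (x , x∈) = ∅ (fsuc x , there x∈)
    member-separated : ∀ {S} → Empty (X ∩ W) → CSMember X Y S →
      S ⊆ outside ∷ W ⊎ Empty (S ∩ (outside ∷ W))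
    member-separated X∩W=∅ (inj₁ refl) = inj₂ λ where (fsuc x , there x∈) → X∩W=∅ (x , x∈)
    member-separated X∩W=∅ (inj₂ (u , _ , refl)) with u ∈? W
    ... | yes u∈W = inj₁ λ x∈ → subst (_∈ outside ∷ W) (sym (x∈⁅y⁆⇒x≡y _ x∈)) (there u∈W)
    ... | no  u∉W = inj₂ λ (x , x∈) → let x∈⁅u⁆ , x∈W = x∈p∩q⁻ ⁅ fsuc u ⁆ _ x∈
                                      in u∉W (drop-there (subst (_∈ outside ∷ W) (x∈⁅y⁆⇒x≡y _ x∈⁅u⁆) x∈W))

separatesᵇ-cs : ∀ {n} {Y Z W : Subset n} → W ⊆ Y → separatesᵇ (cs (Y ─ Z) Y) W ≡ does (W ⊆? Z)
separatesᵇ-cs {Y = Y} {Z} {W} W⊆Y = does-⇔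
  (mk⇔ (Equivalence.to disjoint ∘ proj₂ ∘ Equivalence.to separates)
       (λ W⊆Z → Equivalence.from separates (W⊆Y , Equivalence.from disjoint W⊆Z)))
  (separates? (cs (Y ─ Z) Y) W) (W ⊆? Z)
  where
  separates : Separates (cs (Y ─ Z) Y) W ⇔ (W ⊆ Y × Empty ((Y ─ Z) ∩ W))
  separates = separates-cs⇔
  disjoint : Empty ((Y ─ Z) ∩ W) ⇔ W ⊆ Z
  disjoint = disjoint-from-─⇔ W⊆Y

cs-injective : ∀ {n} {X Y X′ Y′ : Subset n} → cs X Y ≗ cs X′ Y′ → X ≡ X′ × Y ≡ Y′
cs-injective {X = X} {Y} {X′} {Y′} cs≗cs =
  zero-members (∈-cs⁻ (trans (sym (cs≗cs (inside ∷ X))) (zero-member-cs {X = X} {Y}))) ,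
  trans (sym (sing-cs {X = X} {Y})) (trans (sing-cong cs≗cs) (sing-cs {X = X′} {Y′}))
  where
  zero-members : CSMember X′ Y′ (inside ∷ X) → X ≡ X′
  zero-members (inj₁ eq) = ∷-injectiveʳ eq

-- The coefficients are the up-sums of the weights; parity-möbius inverts them against the
-- down-sums that the CS-patterns produce.
module Representation {n} (D : List (Pat n)) where

  eligible : Subset n → Pat n → Bool
  eligible Y p = not (p ⊥) ∧ does (sing p ≟ₛ Y)

  weight : Subset n → Subset n → Bool
  weight Y V = parityOf (λ p → eligible Y p ∧ separatesᵇ p V) D

  coefficient : Subset n → Subset n → Bool
  coefficient Y Z = parity n (λ V → does (Z ⊆? V) ∧ weight Y V)

  coefficient-⊆ : ∀ {Y Z} → coefficient Y Z ≡ true → Z ⊆ Y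
  coefficient-⊆ {Y} {Z} odd with parity-true⇒∃ n _ odd
  ... | V , Z⊆V∧w with ∧≡true⇒ Z⊆V∧w
  ... | Z⊆V , w with parityOf-true⇒∃ (λ p → eligible Y p ∧ separatesᵇ p V) D w
  ... | p , p-counted with ∧≡true⇒ {eligible Y p} {separatesᵇ p V} p-counted
  ... | p-eligible , separates = ⊆-trans (does⇒ (Z ⊆? V) Z⊆V)
    (subst (V ⊆_) (does⇒ (sing p ≟ₛ Y) (proj₂ (∧≡true⇒ {not (p ⊥)} p-eligible)))
                  (proj₁ (does⇒ (separates? p V) separates)))

  csOf : Subset n × Subset n → Pat n
  csOf (Y , Z) = cs (Y ─ Z) Y

  pairs : List (Subset n × Subset n)
  pairs = cartesianProduct (subsets n) (subsets n)

  odd-coefficient? : Decidable (λ ((Y , Z) : Subset n × Subset n) → coefficient Y Z ≡ true)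
  odd-coefficient? (Y , Z) = coefficient Y Z ≟ true

  keys : List (Subset n × Subset n)
  keys = filter odd-coefficient? pairs

  C : List (Pat n)
  C = map csOf keys

  C-isCS : All IsCS C
  C-isCS = All.map⁺ (All.universal (λ (Y , Z) → cs-isCS (p─q⊆p Y Z)) keys)

  C-patterns : All (λ p → IsPattern p × Complete p) C
  C-patterns = All.map⁺ (All.universal (λ (Y , Z) → cs-isPattern , cs-complete (p─q⊆p Y Z)) keys)

  C-distinct : AllPairs (λ p p′ → ¬ (p ≗ p′)) C
  C-distinct = AllPairs.map⁺ (AllPairs-mapWithAll (λ odd odd′ k≢k′ → k≢k′ ∘ csOf-injective odd odd′)
    (All.all-filter odd-coefficient? pairs)
    (AllPairs.filter⁺ odd-coefficient? (Unique.cartesianProduct⁺ (subsets-unique n) (subsets-unique n))))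
    where
    csOf-injective : ∀ {Y Z Y′ Z′} → coefficient Y Z ≡ true → coefficient Y′ Z′ ≡ true →
      csOf (Y , Z) ≗ csOf (Y′ , Z′) → (Y , Z) ≡ (Y′ , Z′)
    csOf-injective {Y} {Z} {Y′} {Z′} odd odd′ cs≗cs with cs-injective cs≗cs
    ... | X≡X′ , refl = cong (Y ,_) (begin
      Z            ≡⟨ sym (─-involutive (coefficient-⊆ odd)) ⟩
      Y ─ (Y ─ Z)  ≡⟨ cong (Y ─_) X≡X′ ⟩
      Y ─ (Y ─ Z′) ≡⟨ ─-involutive (coefficient-⊆ odd′) ⟩
      Z′           ∎)
      where open ≡-Reasoning

  module _ (q : Pat n) where
    private
      L : Subset n
      L = sing q

      lower : Subset n → Bool
      lower Z = parity n (λ W → does (W ⊆? Z) ∧ separatesᵇ q W)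

      total : Bool
      total = not (q ⊥) ∧ parity n (λ V → weight L V ∧ separatesᵇ q V)

    consistentᵇ-cs : ∀ Y Z → consistentᵇ (cs (Y ─ Z) Y) q ≡ not (q ⊥) ∧ (does (Y ≟ₛ L) ∧ lower Z)
    consistentᵇ-cs Y Z = trans
      (cong₂ (λ b S → not b ∧ (not (q ⊥) ∧ (does (S ≟ₛ L) ∧ common)))
             (⊥∉cs {X = Y ─ Z} {Y}) (sing-cs {X = Y ─ Z} {Y}))
      (cong (not (q ⊥) ∧_) (guarded Y))
      where
      common : Bool
      common = parity n (λ W → separatesᵇ (cs (Y ─ Z) Y) W ∧ separatesᵇ q W)
      guarded : ∀ Y → does (Y ≟ₛ L) ∧ parity n (λ W → separatesᵇ (cs (Y ─ Z) Y) W ∧ separatesᵇ q W)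
                      ≡ does (Y ≟ₛ L) ∧ lower Z
      guarded Y with Y ≟ₛ L
      ... | no  _    = refl
      ... | yes refl = parity-cong n pointwise
        where
        pointwise : ∀ W → separatesᵇ (cs (L ─ Z) L) W ∧ separatesᵇ q W ≡ does (W ⊆? Z) ∧ separatesᵇ q W
        pointwise W with separatesᵇ q W in sep
        ... | false = trans (∧-zeroʳ _) (sym (∧-zeroʳ _))
        ... | true  = cong (_∧ true) (separatesᵇ-cs (proj₁ (does⇒ (separates? q W) sep)))

    parity-C : parityOf (λ c → consistentᵇ c q) C ≡ total
    parity-C = begin
      parityOf (λ c → consistentᵇ c q) (map csOf keys)
        ≡⟨ parityOf-map _ csOf keys ⟩
      parityOf (λ k → consistentᵇ (csOf k) q) keys
        ≡⟨ parityOf-filter (λ k → consistentᵇ (csOf k) q) (λ (Y , Z) → coefficient Y Z) pairs ⟩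
      parityOf (λ (Y , Z) → coefficient Y Z ∧ consistentᵇ (cs (Y ─ Z) Y) q) pairs
        ≡⟨ parityOf-cartesianProduct _ (subsets n) (subsets n) ⟩
      parityOf (λ Y → parityOf (λ Z → coefficient Y Z ∧ consistentᵇ (cs (Y ─ Z) Y) q) (subsets n)) (subsets n)
        ≡⟨ trans (parityOf-cong (subsets n) λ Y → parityOf-subsets n _) (parityOf-subsets n _) ⟩
      parity n (λ Y → parity n (λ Z → coefficient Y Z ∧ consistentᵇ (cs (Y ─ Z) Y) q))
        ≡⟨ parity-cong n (λ Y → parity-cong n λ Z → rearrange Y Z) ⟩
      parity n (λ Y → parity n (λ Z → not (q ⊥) ∧ (does (Y ≟ₛ L) ∧ (coefficient Y Z ∧ lower Z))))
        ≡⟨ parity-cong n (λ Y → trans (sym (∧-distribˡ-parity n (not (q ⊥)) _))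
                                      (cong (not (q ⊥) ∧_) (sym (∧-distribˡ-parity n (does (Y ≟ₛ L)) _)))) ⟩
      parity n (λ Y → not (q ⊥) ∧ (does (Y ≟ₛ L) ∧ parity n (λ Z → coefficient Y Z ∧ lower Z)))
        ≡⟨ sym (∧-distribˡ-parity n (not (q ⊥)) _) ⟩
      not (q ⊥) ∧ parity n (λ Y → does (Y ≟ₛ L) ∧ parity n (λ Z → coefficient Y Z ∧ lower Z))
        ≡⟨ cong (not (q ⊥) ∧_) (parity-point n L _) ⟩
      not (q ⊥) ∧ parity n (λ Z → coefficient L Z ∧ lower Z)
        ≡⟨ cong (not (q ⊥) ∧_) (parity-möbius n (weight L) (separatesᵇ q)) ⟩
      total ∎
      where
      open ≡-Reasoning
      rearrange : ∀ Y Z → coefficient Y Z ∧ consistentᵇ (cs (Y ─ Z) Y) q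
                          ≡ not (q ⊥) ∧ (does (Y ≟ₛ L) ∧ (coefficient Y Z ∧ lower Z))
      rearrange Y Z = trans (cong (coefficient Y Z ∧_) (consistentᵇ-cs Y Z))
        (trans (∧.x∙yz≈y∙xz (coefficient Y Z) (not (q ⊥)) _)
               (cong (not (q ⊥) ∧_) (∧.x∙yz≈y∙xz (coefficient Y Z) (does (Y ≟ₛ L)) (lower Z))))

    parity-D : parityOf (λ p → consistentᵇ p q) D ≡ total
    parity-D = begin
      parityOf (λ p → consistentᵇ p q) D
        ≡⟨ parityOf-cong D rearrange ⟩
      parityOf (λ p → not (q ⊥) ∧ parity n (λ W → (eligible L p ∧ separatesᵇ p W) ∧ separatesᵇ q W)) D
        ≡⟨ sym (∧-distribˡ-parityOf (not (q ⊥)) _ D) ⟩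
      not (q ⊥) ∧ parityOf (λ p → parity n (λ W → (eligible L p ∧ separatesᵇ p W) ∧ separatesᵇ q W)) D
        ≡⟨ cong (not (q ⊥) ∧_) (parityOf-parity n _ D) ⟩
      not (q ⊥) ∧ parity n (λ W → parityOf (λ p → (eligible L p ∧ separatesᵇ p W) ∧ separatesᵇ q W) D)
        ≡⟨ cong (not (q ⊥) ∧_) (parity-cong n λ W → sym (∧-distribʳ-parityOf (separatesᵇ q W) _ D)) ⟩
      total ∎
      where
      open ≡-Reasoning
      rearrange : ∀ p → consistentᵇ p q
                        ≡ not (q ⊥) ∧ parity n (λ W → (eligible L p ∧ separatesᵇ p W) ∧ separatesᵇ q W)
      rearrange p = trans (∧.x∙yz≈y∙xz (not (p ⊥)) (not (q ⊥)) _) (cong (not (q ⊥) ∧_)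
        (trans (sym (∧-assoc (not (p ⊥)) _ _)) (trans (∧-distribˡ-parity n (eligible L p) _)
          (parity-cong n λ W → sym (∧-assoc (eligible L p) _ _)))))

    parity-C≡parity-D : parityOf (λ c → consistentᵇ c q) C ≡ parityOf (λ p → consistentᵇ p q) D
    parity-C≡parity-D = trans parity-C (sym parity-D)

corollary8p13 : (n : ℕ) (D : List (Pat n)) →
    All (λ p → IsPattern p × Complete p) D →
    AllPairs (λ p p′ → ¬ (p ≗ p′)) D →
    Σ (List (Pat n)) λ C →
      All IsCS C × AllPairs (λ p p′ → ¬ (p ≗ p′)) C ×
      ((q : Pat n) → IsPattern q → Complete q →
        (k l : ℕ) → Count (λ p → p ∼ q) C k → Count (λ p → p ∼ q) D l →
        k % 2 ≡ l % 2)
corollary8p13 n D D-patterns _ =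
  C , C-isCS , C-distinct , λ q q-pattern q-complete k l count-C count-D →
    let decided = consistency-decided q-pattern q-complete in odd⇒%2 {k} {l} (begin
      odd k                              ≡⟨ count-odd (λ c → consistentᵇ c q) count-C (decided C-patterns) ⟩
      parityOf (λ c → consistentᵇ c q) C ≡⟨ parity-C≡parity-D q ⟩
      parityOf (λ p → consistentᵇ p q) D ≡⟨ count-odd (λ p → consistentᵇ p q) count-D (decided D-patterns) ⟨
      odd l                              ∎)
  where
  open Representation D
  open ≡-Reasoning
  consistency-decided : ∀ {q} → IsPattern q → Complete q → ∀ {xs} →
    All (λ p → IsPattern p × Complete p) xs → All (λ p → (p ∼ q) ⇔ (consistentᵇ p q ≡ true)) xs
  consistency-decided q-pattern q-complete =
    All.map λ (p-pattern , p-complete) → ∼⇔consistentᵇ p-pattern p-complete q-pattern q-complete
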